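{- Let $T$ be a rooted-signed-binary tree. The permutation produced from $T$ by the insertion construction does not depend on the processing order chosen: any two processing orders of the nodes of $T$ produce the same cycle.
   Context: A rooted-signed-binary tree is a finite rooted binary tree (each node has at most one left and at most one right child) in which every non-root node has a sign $+$ or $-$; the root is unsigned. A tree with $m$ nodes has $m+1$ empty child slots (places where a new leaf may be attached), ordered from left to right in symmetric (in-order) order. If $v$ is a non-root leaf of $T$, $T-\{v\}$ is $T$ with $v$ deleted, and $v$ is in relative position $i$ if it occupies the $i$-th empty slot (from the left) of $T-\{v\}$. Construction: for an integer $m$ let $\xi_m(k)=k$ for $k<m$ and $\xi_m(k)=k+1$ for $k\ge m$. For a permutation $s_1\cdots s_n$ (one-line notation) and $1\le i\le n$, the positive insertion at $i$ gives $\xi_{i+1}(s_1)\cdots \xi_{i+1}(s_{i-1})\,(i{+}1)\,\xi_{i+1}(s_{i})\cdots \xi_{i+1}(s_{n})$ and the negative insertion at $i$ gives $\xi_{i}(s_1)\cdots \xi_{i}(s_{i})\,(i)\,\xi_{i}(s_{i+1})\cdots \xi_{i}(s_{n})$. A processing order of $T$ is a listing of its non-root nodes in which every node comes after its parent (when the parent is not the root). Starting from $21$ for the root alone, process the nodes in order: when $v$ is processed it is a leaf of the tree $T_v$ formed by the root, the previously processed nodes and $v$; if $v$ is in relative position $i$ in $T_v$, apply the positive insertion at $i$ if $v$ is $+$ and the negative insertion at $i$ if $v$ is $-$. The final permutation is the cycle produced. -}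

module Defs where

open import Data.Nat using (ℕ; zero; suc; _<ᵇ_)
open import Data.Bool using (Bool; true; false; if_then_else_; _∧_)
open import Data.List using (List; []; _∷_; _++_; map; take; drop; _∷ʳ_)
open import Data.Bool.ListAction using (any)
open import Data.Maybe using (Maybe; just; nothing)
open import Data.Product using (∃; _×_)
open import Data.List.Membership.Propositional using (_∈_)
open import Data.List.Relation.Unary.All using (All)
open import Data.List.Relation.Unary.Unique.Propositional using (Unique)
open import Relation.Binary.PropositionalEquality using (_≡_; _≢_)

data Sign : Set where
  plus minus : Sign

data Sub : Set where
  empty : Sub
  node  : Sign → Sub → Sub → Sub

-- A rooted-signed-binary tree: an unsigned root with a left and a right
-- (possibly empty) subtree, all of whose nodes are signed.
data Tree : Set where
  root : Sub → Sub → Tree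

data Dir : Set where
  L R : Dir

-- Nodes are addressed by the path of left/right steps from the root.
Path : Set
Path = List Dir

_==D_ : Dir → Dir → Bool
L ==D L = true
R ==D R = true
_ ==D _ = false

_==P_ : Path → Path → Bool
[] ==P [] = true
(d ∷ p) ==P (e ∷ q) = (d ==D e) ∧ (p ==P q)
_ ==P _ = false

_∈ᵇ_ : Path → List Path → Bool
p ∈ᵇ ps = any (p ==P_) ps

signSub : Sub → Path → Maybe Sign
signSub empty        _       = nothing
signSub (node s l r) []      = just s
signSub (node s l r) (L ∷ p) = signSub l p
signSub (node s l r) (R ∷ p) = signSub r p

signAt : Tree → Path → Maybe Sign
signAt (root l r) []      = nothing
signAt (root l r) (L ∷ p) = signSub l p
signAt (root l r) (R ∷ p) = signSub r p

IsNode : Tree → Path → Set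
IsNode T p = ∃ λ s → signAt T p ≡ just s

record ProcessingOrder (T : Tree) (ord : List Path) : Set where
  field
    nodes    : All (IsNode T) ord
    unique   : Unique ord
    complete : ∀ p → IsNode T p → p ∈ ord
    parentFirst : ∀ xs v ys → ord ≡ xs ++ (v ∷ ys) →
                  ∀ p d → v ≡ p ∷ʳ d → p ≢ [] → p ∈ xs

restrictSub : (Path → Bool) → Sub → Sub
restrictSub keep empty = empty
restrictSub keep (node s l r) =
  if keep [] then node s (restrictSub (λ p → keep (L ∷ p)) l)
                         (restrictSub (λ p → keep (R ∷ p)) r)
             else empty

restrict : List Path → Tree → Tree
restrict ps (root l r) =
  root (restrictSub (λ p → (L ∷ p) ∈ᵇ ps) l) (restrictSub (λ p → (R ∷ p) ∈ᵇ ps) r)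

-- empty child slots, from left to right in symmetric (in-order) order,
-- given as the path a new leaf in that slot would have
slotsSub : Sub → List Path
slotsSub empty        = [] ∷ []
slotsSub (node s l r) = map (L ∷_) (slotsSub l) ++ map (R ∷_) (slotsSub r)

slots : Tree → List Path
slots (root l r) = map (L ∷_) (slotsSub l) ++ map (R ∷_) (slotsSub r)

-- 1-based position of p in a list (junk value if absent)
position : Path → List Path → ℕ
position p []       = 1
position p (q ∷ qs) = if p ==P q then 1 else suc (position p qs)

ξ : ℕ → ℕ → ℕ
ξ m k = if k <ᵇ m then k else suc k

posIns : ℕ → List ℕ → List ℕ
posIns i s = map (ξ (suc i)) (take (i Data.Nat.∸ 1) s) ++ (suc i ∷ map (ξ (suc i)) (drop (i Data.Nat.∸ 1) s))

negIns : ℕ → List ℕ → List ℕ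
negIns i s = map (ξ i) (take i s) ++ (i ∷ map (ξ i) (drop i s))

insert : Maybe Sign → ℕ → List ℕ → List ℕ
insert (just plus)  i s = posIns i s
insert (just minus) i s = negIns i s
insert nothing      i s = s

processFrom : Tree → List Path → List Path → List ℕ → List ℕ
processFrom T done []        s = s
processFrom T done (v ∷ vs)  s =
  processFrom T (done ∷ʳ v) vs
    (insert (signAt T v) (position v (slots (restrict done T))) s)

produce : Tree → List Path → List ℕ
produce T ord = processFrom T [] ord (2 ∷ 1 ∷ [])

-- After processing a set of nodes closed under ancestors, the permutation is the
-- single cycle through the empty slots of the tree built so far that visits them
-- in the order wordSub: below a + node the left slots come before the right ones,
-- below a − node after them, the root counting as +. Processing a leaf v of sign
-- σ replaces the slot v by the two slots of its children, both in the left-to-right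
-- order of slots and in the cycle (consecutively, in the order σ prescribes), and
-- a direct computation shows that this is exactly the σ-insertion at the position
-- of v. Hence every processing order ends with the cycle of T itself.
module Submission where

open import Defs
open import Data.Bool using (Bool; true; false; if_then_else_; _∨_)
open import Data.Empty using (⊥-elim)
open import Data.List using (List; []; _∷_; _++_; map; take; drop; _∷ʳ_; length; [_])
open import Data.List.Properties
  using (++-assoc; ++-identityʳ; ++-identityʳ-unique; map-++; map-∘; map-cong-local;
         length-map; length-++; ∷ʳ-++; ∷-injectiveʳ)
open import Data.List.Membership.Propositional using (_∈_; _∉_)
open import Data.List.Membership.Propositional.Properties using (∈-∃++; ∈-++⁻; ∈-++⁺ˡ; ∈-++⁺ʳ; ∈-map⁻)
open import Data.List.Relation.Binary.Subset.Propositional using (_⊆_)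
open import Data.List.Relation.Binary.Permutation.Propositional using (_↭_; ↭-refl; ↭-trans; ↭-sym; ↭⇒↭ₛ)
import Data.List.Relation.Binary.Permutation.Propositional.Properties as ↭
import Data.List.Relation.Binary.Permutation.Setoid.Properties as ↭ₛ
open import Data.List.Relation.Unary.All as All using (All; []; _∷_)
open import Data.List.Relation.Unary.Any using (here; there)
open import Data.List.Relation.Unary.Unique.Propositional using (Unique; []; _∷_)
import Data.List.Relation.Unary.Unique.Propositional.Properties as Unique
open import Data.Maybe using (just; nothing)
open import Data.Nat using (ℕ; zero; suc; _+_; _<ᵇ_; _≤_; _<_; z≤n; s≤s)
open import Data.Nat.Properties using (≤-refl; ≤-trans; n≤1+n; n<1+n; +-comm)
open import Data.Product using (∃₂; _×_; _,_; proj₁; proj₂)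
open import Data.Sum using (inj₁; inj₂)
open import Function using (_∘_)
open import Relation.Nullary using (¬_)
open import Relation.Binary.PropositionalEquality
  using (_≡_; _≢_; refl; sym; trans; cong; cong₂; subst; setoid; module ≡-Reasoning)

open ≡-Reasoning

==D⇒≡ : ∀ {d e} → (d ==D e) ≡ true → d ≡ e
==D⇒≡ {L} {L} _ = refl
==D⇒≡ {R} {R} _ = refl
==D⇒≡ {L} {R} ()
==D⇒≡ {R} {L} ()

==P⇒≡ : ∀ {p q} → (p ==P q) ≡ true → p ≡ q
==P⇒≡ {[]}    {[]}    _  = refl
==P⇒≡ {d ∷ p} {e ∷ q} eq with d ==D e in d==e
... | true  = cong₂ _∷_ (==D⇒≡ d==e) (==P⇒≡ eq)
==P⇒≡ {[]}    {_ ∷ _} ()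
==P⇒≡ {_ ∷ _} {[]}    ()

==P-refl : ∀ p → (p ==P p) ≡ true
==P-refl []      = refl
==P-refl (L ∷ p) = ==P-refl p
==P-refl (R ∷ p) = ==P-refl p

≢⇒==P-false : ∀ {p q} → p ≢ q → (p ==P q) ≡ false
≢⇒==P-false {p} {q} p≢q with p ==P q in eq
... | true  = ⊥-elim (p≢q (==P⇒≡ eq))
... | false = refl

∈⇒∈ᵇ : ∀ {p ps} → p ∈ ps → (p ∈ᵇ ps) ≡ true
∈⇒∈ᵇ {p} (here refl) rewrite ==P-refl p = refl
∈⇒∈ᵇ {p} {q ∷ _} (there p∈ps) with p ==P q
... | true  = refl
... | false = ∈⇒∈ᵇ p∈ps

∉⇒∈ᵇ-false : ∀ {p ps} → p ∉ ps → (p ∈ᵇ ps) ≡ false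
∉⇒∈ᵇ-false {ps = []}    _    = refl
∉⇒∈ᵇ-false {ps = _ ∷ _} p∉ps rewrite ≢⇒==P-false (p∉ps ∘ here) = ∉⇒∈ᵇ-false (p∉ps ∘ there)

∈ᵇ-∷ʳ-≢ : ∀ {p v} ps → p ≢ v → (p ∈ᵇ (ps ∷ʳ v)) ≡ (p ∈ᵇ ps)
∈ᵇ-∷ʳ-≢ []       p≢v rewrite ≢⇒==P-false p≢v = refl
∈ᵇ-∷ʳ-≢ {p} (q ∷ ps) p≢v = cong ((p ==P q) ∨_) (∈ᵇ-∷ʳ-≢ ps p≢v)

∈∉⇒≢ : ∀ {A : Set} {x y : A} {xs} → x ∈ xs → y ∉ xs → x ≢ y
∈∉⇒≢ x∈xs y∉xs refl = y∉xs x∈xs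

∉-middle : ∀ {A : Set} {x v : A} xs {ys} → x ∉ xs → x ≢ v → x ∉ ys → x ∉ xs ++ v ∷ ys
∉-middle xs x∉xs x≢v x∉ys x∈ with ∈-++⁻ xs x∈
... | inj₁ x∈xs         = x∉xs x∈xs
... | inj₂ (here x≡v)   = x≢v x≡v
... | inj₂ (there x∈ys) = x∉ys x∈ys

unique-middle : ∀ {A : Set} xs {x : A} {ys} → Unique (xs ++ x ∷ ys) → x ∉ xs × x ∉ ys
unique-middle []       (x∉ ∷ _) = (λ ()) , λ x∈ys → All.lookup x∉ x∈ys refl
unique-middle (z ∷ xs) (z∉ ∷ u) with unique-middle xs u
... | x∉xs , x∉ys = ∉-middle [] (λ ()) (λ { refl → All.lookup z∉ (∈-++⁺ʳ xs (here refl)) refl }) x∉xs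
                    , x∉ys

++-∷-≢ : ∀ {A : Set} (xs : List A) {y ys} → xs ++ y ∷ ys ≢ xs
++-∷-≢ xs eq with () ← ++-identityʳ-unique xs (sym eq)

∷ʳ-≢-[] : ∀ {A : Set} (xs : List A) {x} → xs ∷ʳ x ≢ []
∷ʳ-≢-[] []      ()
∷ʳ-≢-[] (_ ∷ _) ()

take-length-++ : ∀ {A : Set} (xs : List A) {ys n} → length xs ≡ n → take n (xs ++ ys) ≡ xs
take-length-++ []       refl = refl
take-length-++ (x ∷ xs) refl = cong (x ∷_) (take-length-++ xs refl)

drop-length-++ : ∀ {A : Set} (xs : List A) {ys n} → length xs ≡ n → drop n (xs ++ ys) ≡ ys
drop-length-++ []       refl = refl
drop-length-++ (x ∷ xs) refl = drop-length-++ xs refl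

ξ-suc : ∀ m k → ξ (suc m) (suc k) ≡ suc (ξ m k)
ξ-suc m k with k <ᵇ m
... | true  = refl
... | false = refl

ξ-< : ∀ {m k} → k < m → ξ m k ≡ k
ξ-< {suc m} {zero}  _         = refl
ξ-< {suc m} {suc k} (s≤s k<m) = trans (ξ-suc m k) (cong suc (ξ-< k<m))

ξ-≥ : ∀ {m k} → m ≤ k → ξ m k ≡ suc k
ξ-≥ {zero}  {k}     _         = refl
ξ-≥ {suc m} {suc k} (s≤s m≤k) = trans (ξ-suc m k) (cong suc (ξ-≥ m≤k))

posIns-middle : ∀ xs {y ys n} → length xs ≡ n →
  posIns (suc n) (xs ++ y ∷ ys) ≡ map (ξ (2 + n)) xs ++ 2 + n ∷ map (ξ (2 + n)) (y ∷ ys)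
posIns-middle xs |xs| =
  cong₂ (λ us ws → map _ us ++ _ ∷ map _ ws) (take-length-++ xs |xs|) (drop-length-++ xs |xs|)

negIns-middle : ∀ xs {y ys n} → length xs ≡ n →
  negIns (suc n) (xs ++ y ∷ ys) ≡ map (ξ (suc n)) xs ++ ξ (suc n) y ∷ suc n ∷ map (ξ (suc n)) ys
negIns-middle xs {y} {ys} {n} |xs| = begin
  negIns (suc n) (xs ++ y ∷ ys)
    ≡⟨ cong (negIns (suc n)) (sym (∷ʳ-++ xs y ys)) ⟩
  negIns (suc n) (xs ∷ʳ y ++ ys)
    ≡⟨ cong₂ (λ us ws → map (ξ (suc n)) us ++ suc n ∷ map (ξ (suc n)) ws)
             (take-length-++ (xs ∷ʳ y) |xs∷ʳy|) (drop-length-++ (xs ∷ʳ y) |xs∷ʳy|) ⟩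
  map (ξ (suc n)) (xs ∷ʳ y) ++ suc n ∷ map (ξ (suc n)) ys
    ≡⟨ cong (_++ suc n ∷ map (ξ (suc n)) ys) (map-++ (ξ (suc n)) xs [ y ]) ⟩
  (map (ξ (suc n)) xs ∷ʳ ξ (suc n) y) ++ suc n ∷ map (ξ (suc n)) ys
    ≡⟨ ∷ʳ-++ (map (ξ (suc n)) xs) (ξ (suc n) y) _ ⟩
  map (ξ (suc n)) xs ++ ξ (suc n) y ∷ suc n ∷ map (ξ (suc n)) ys ∎
  where
  |xs∷ʳy| : length (xs ∷ʳ y) ≡ suc n
  |xs∷ʳy| = trans (length-++ xs) (trans (+-comm (length xs) 1) (cong suc |xs|))

position-middle : ∀ xs {x ys} → x ∉ xs → position x (xs ++ x ∷ ys) ≡ suc (length xs)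
position-middle []       {x} _    rewrite ==P-refl x = refl
position-middle (z ∷ xs)     x∉ rewrite ≢⇒==P-false (x∉ ∘ here) =
  cong suc (position-middle xs (x∉ ∘ there))

position-after : ∀ xs {x y ys} → x ∉ xs → x ≢ y → position x (xs ++ y ∷ x ∷ ys) ≡ 2 + length xs
position-after []       {x} _  x≢y rewrite ≢⇒==P-false x≢y | ==P-refl x = refl
position-after (z ∷ xs)     x∉ x≢y rewrite ≢⇒==P-false (x∉ ∘ here) =
  cong suc (position-after xs (x∉ ∘ there) x≢y)

position-positive : ∀ x ys → 1 ≤ position x ys
position-positive x []       = s≤s z≤n
position-positive x (y ∷ ys) with x ==P y
... | true  = s≤s z≤n
... | false = s≤s z≤n

-- Splitting v into a, b shifts by one exactly the positions beyond v's; any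
-- threshold t between v's position and the next one separates the two kinds.
position-split : ∀ xs {ys v a b y t} → length xs < t → t ≤ 2 + length xs →
  y ≢ v → y ≢ a → y ≢ b → position y (xs ++ a ∷ b ∷ ys) ≡ ξ t (position y (xs ++ v ∷ ys))
position-split [] {ys} {y = y} _ t≤2 y≢v y≢a y≢b
  rewrite ≢⇒==P-false y≢v | ≢⇒==P-false y≢a | ≢⇒==P-false y≢b =
  sym (ξ-≥ (≤-trans t≤2 (s≤s (position-positive y ys))))
position-split (z ∷ xs) {y = y} {t = suc t} (s≤s |xs|<t) (s≤s t≤) y≢v y≢a y≢b with y ==P z
... | true  = sym (ξ-< (s≤s (≤-trans (s≤s z≤n) |xs|<t)))
... | false = trans (cong suc (position-split xs |xs|<t t≤ y≢v y≢a y≢b)) (sym (ξ-suc t _))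

headOr : Path → List Path → Path
headOr f []      = f
headOr _ (y ∷ _) = y

successorOr : Path → List Path → Path → Path
successorOr f []       x = f
successorOr f (y ∷ ys) x = if x ==P y then headOr f ys else successorOr f ys x

successor : List Path → Path → Path
successor W x = successorOr (headOr x W) W x

headOr-∈ : ∀ {f U} W → f ∈ U → W ⊆ U → headOr f W ∈ U
headOr-∈ []      f∈U _   = f∈U
headOr-∈ (_ ∷ _) _   W⊆U = W⊆U (here refl)

successorOr-∈ : ∀ {f U} W x → f ∈ U → W ⊆ U → successorOr f W x ∈ U
successorOr-∈ []       x f∈U _   = f∈U
successorOr-∈ (y ∷ ys) x f∈U W⊆U with x ==P y
... | true  = headOr-∈ ys f∈U (W⊆U ∘ there)
... | false = successorOr-∈ ys x f∈U (W⊆U ∘ there)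

successor-∈ : ∀ W x → successor W x ∈ x ∷ W
successor-∈ W x = successorOr-∈ W x (headOr-∈ W (here refl) there) there

rename : Path → Path → Path → Path
rename c v y = if y ==P v then c else y

rename-≢ : ∀ {c v y} → y ≢ v → rename c v y ≡ y
rename-≢ y≢v rewrite ≢⇒==P-false y≢v = refl

rename-self : ∀ c v → rename c v v ≡ c
rename-self c v rewrite ==P-refl v = refl

headOr-rename : ∀ {c v} f Q → v ∉ Q → headOr (rename c v f) Q ≡ rename c v (headOr f Q)
headOr-rename f []      _   = refl
headOr-rename f (q ∷ Q) v∉Q = sym (rename-≢ (∈∉⇒≢ (here refl) v∉Q))

successorOr-rename : ∀ {c v} f Q x → v ∉ Q →
  successorOr (rename c v f) Q x ≡ rename c v (successorOr f Q x)
successorOr-rename f []      x _   = refl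
successorOr-rename f (q ∷ Q) x v∉Q with x ==P q
... | true  = headOr-rename f Q (v∉Q ∘ there)
... | false = successorOr-rename f Q x (v∉Q ∘ there)

-- Below, P ++ c₁ ∷ c₂ ∷ Q arises from P ++ v ∷ Q by renaming v to c₁ and
-- inserting c₂ right after it.
headOr-splice : ∀ {c₁ c₂ v} f g P Q → v ∉ P →
  headOr g (P ++ c₁ ∷ c₂ ∷ Q) ≡ rename c₁ v (headOr f (P ++ v ∷ Q))
headOr-splice {c₁} {v = v} f g []      Q _   = sym (rename-self c₁ v)
headOr-splice               f g (p ∷ P) Q v∉P = sym (rename-≢ (∈∉⇒≢ (here refl) v∉P))

successorOr-splice : ∀ {c₁ c₂ v} f P Q x → v ∉ P → v ∉ Q → x ≢ c₁ → x ≢ c₂ → x ≢ v →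
  successorOr (rename c₁ v f) (P ++ c₁ ∷ c₂ ∷ Q) x ≡ rename c₁ v (successorOr f (P ++ v ∷ Q) x)
successorOr-splice f [] Q x _ v∉Q x≢c₁ x≢c₂ x≢v
  rewrite ≢⇒==P-false x≢c₁ | ≢⇒==P-false x≢c₂ | ≢⇒==P-false x≢v = successorOr-rename f Q x v∉Q
successorOr-splice f (p ∷ P) Q x v∉P v∉Q x≢c₁ x≢c₂ x≢v with x ==P p
... | true  = headOr-splice f _ P Q (v∉P ∘ there)
... | false = successorOr-splice f P Q x (v∉P ∘ there) v∉Q x≢c₁ x≢c₂ x≢v

successorOr-splice-first : ∀ {c₁ c₂} g P Q → c₁ ∉ P → successorOr g (P ++ c₁ ∷ c₂ ∷ Q) c₁ ≡ c₂
successorOr-splice-first {c₁} g []      Q _    rewrite ==P-refl c₁ = refl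
successorOr-splice-first {c₁} g (p ∷ P) Q c₁∉P rewrite ≢⇒==P-false (c₁∉P ∘ here) =
  successorOr-splice-first g P Q (c₁∉P ∘ there)

successorOr-splice-second : ∀ {c₁ c₂ v} f P Q → c₂ ∉ P → v ∉ P → v ∉ Q → c₂ ≢ c₁ →
  successorOr (rename c₁ v f) (P ++ c₁ ∷ c₂ ∷ Q) c₂ ≡ rename c₁ v (successorOr f (P ++ v ∷ Q) v)
successorOr-splice-second {c₂ = c₂} {v} f [] Q _ _ v∉Q c₂≢c₁
  rewrite ≢⇒==P-false c₂≢c₁ | ==P-refl c₂ | ==P-refl v = headOr-rename f Q v∉Q
successorOr-splice-second f (p ∷ P) Q c₂∉P v∉P v∉Q c₂≢c₁
  rewrite ≢⇒==P-false (c₂∉P ∘ here) | ≢⇒==P-false (v∉P ∘ here) =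
  successorOr-splice-second f P Q (c₂∉P ∘ there) (v∉P ∘ there) v∉Q c₂≢c₁

-- One-line notation of the cyclic permutation W of the slots, the slots being
-- numbered by their position in S.
cycleOneLine : List Path → List Path → List ℕ
cycleOneLine S W = map (λ x → position (successor W x) S) S

orient : Sign → List Path → List Path → List Path
orient plus  xs ys = xs ++ ys
orient minus xs ys = ys ++ xs

module Splice {A B P Q : List Path} {v a b : Path}
  (S-unique : Unique (A ++ v ∷ B)) (S′-unique : Unique (A ++ a ∷ b ∷ B))
  (W-unique : Unique (P ++ v ∷ Q)) (W⊆S : P ++ v ∷ Q ⊆ A ++ v ∷ B)
  (a≢v : a ≢ v) (b≢v : b ≢ v) where

  S S′ W : List Path
  S  = A ++ v ∷ B
  S′ = A ++ a ∷ b ∷ B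
  W  = P ++ v ∷ Q

  i : ℕ
  i = suc (length A)

  g : Path → ℕ
  g x = position (successor W x) S

  v∉A : v ∉ A
  v∉A = proj₁ (unique-middle A S-unique)

  v∉B : v ∉ B
  v∉B = proj₂ (unique-middle A S-unique)

  v∉P : v ∉ P
  v∉P = proj₁ (unique-middle P W-unique)

  v∉Q : v ∉ Q
  v∉Q = proj₂ (unique-middle P W-unique)

  a∉A : a ∉ A
  a∉A = proj₁ (unique-middle A S′-unique)

  a∉B : a ∉ B
  a∉B = proj₂ (unique-middle A S′-unique) ∘ there

  b∉Aa : b ∉ A ∷ʳ a
  b∉Aa = proj₁ (unique-middle (A ∷ʳ a) (subst Unique (sym (∷ʳ-++ A a (b ∷ B))) S′-unique))

  b∉A : b ∉ A
  b∉A = b∉Aa ∘ ∈-++⁺ˡ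

  b∉B : b ∉ B
  b∉B = proj₂ (unique-middle (A ∷ʳ a) (subst Unique (sym (∷ʳ-++ A a (b ∷ B))) S′-unique))

  b≢a : b ≢ a
  b≢a b≡a = b∉Aa (∈-++⁺ʳ A (here b≡a))

  a∉W : a ∉ W
  a∉W = ∉-middle A a∉A a≢v a∉B ∘ W⊆S

  b∉W : b ∉ W
  b∉W = ∉-middle A b∉A b≢v b∉B ∘ W⊆S

  position-v : position v S ≡ i
  position-v = position-middle A v∉A

  first second : Sign → Path
  first  plus  = a
  first  minus = b
  second plus  = b
  second minus = a

  -- posIns i shifts the values by ξ (suc i), negIns i by ξ i.
  threshold : Sign → ℕ
  threshold plus  = suc i
  threshold minus = i

  A<threshold : ∀ σ → length A < threshold σ
  A<threshold plus  = s≤s (n≤1+n _)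
  A<threshold minus = n<1+n _

  threshold≤ : ∀ σ → threshold σ ≤ 2 + length A
  threshold≤ plus  = ≤-refl
  threshold≤ minus = n≤1+n _

  first∉W : ∀ σ → first σ ∉ W
  first∉W plus  = a∉W
  first∉W minus = b∉W

  second∉W : ∀ σ → second σ ∉ W
  second∉W plus  = b∉W
  second∉W minus = a∉W

  second≢first : ∀ σ → second σ ≢ first σ
  second≢first plus  = b≢a
  second≢first minus = b≢a ∘ sym

  ≢first : ∀ σ {x} → x ≢ a → x ≢ b → x ≢ first σ
  ≢first plus  x≢a _   = x≢a
  ≢first minus _   x≢b = x≢b

  ≢second : ∀ σ {x} → x ≢ a → x ≢ b → x ≢ second σ
  ≢second plus  _   x≢b = x≢b
  ≢second minus x≢a _   = x≢a

  position-first : ∀ σ → position (first σ) S′ ≡ ξ (threshold σ) i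
  position-first plus  = trans (position-middle A a∉A) (sym (ξ-< (n<1+n i)))
  position-first minus = trans (position-after A b∉A b≢a) (sym (ξ-≥ ≤-refl))

  W′ : Sign → List Path
  W′ σ = P ++ first σ ∷ second σ ∷ Q

  g′ : Sign → Path → ℕ
  g′ σ x = position (successor (W′ σ) x) S′

  successor-W-≢ : ∀ {c x} → c ∉ W → x ≢ c → successor W x ≢ c
  successor-W-≢ c∉W x≢c = ∈∉⇒≢ (successor-∈ W _) (∉-middle [] (λ ()) (x≢c ∘ sym) c∉W)

  position-rename : ∀ σ y → y ≢ a → y ≢ b →
    position (rename (first σ) v y) S′ ≡ ξ (threshold σ) (position y S)
  position-rename σ y y≢a y≢b with y ==P v in y==v
  ... | true  with refl ← ==P⇒≡ {y} {v} y==v = trans (position-first σ) (cong (ξ (threshold σ)) (sym position-v))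
  ... | false = position-split A (A<threshold σ) (threshold≤ σ) y≢v y≢a y≢b
    where
    y≢v : y ≢ v
    y≢v refl with () ← trans (sym (==P-refl y)) y==v

  g′-outside : ∀ σ x → x ≢ a → x ≢ b → x ≢ v → g′ σ x ≡ ξ (threshold σ) (g x)
  g′-outside σ x x≢a x≢b x≢v = begin
    position (successorOr (headOr x (W′ σ)) (W′ σ) x) S′
      ≡⟨ cong (λ h → position (successorOr h (W′ σ) x) S′) (headOr-splice x x P Q v∉P) ⟩
    position (successorOr (rename (first σ) v (headOr x W)) (W′ σ) x) S′
      ≡⟨ cong (λ y → position y S′)
              (successorOr-splice (headOr x W) P Q x v∉P v∉Q (≢first σ x≢a x≢b) (≢second σ x≢a x≢b) x≢v) ⟩
    position (rename (first σ) v (successor W x)) S′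
      ≡⟨ position-rename σ (successor W x) (successor-W-≢ a∉W x≢a) (successor-W-≢ b∉W x≢b) ⟩
    ξ (threshold σ) (g x) ∎

  g′-first : ∀ σ → g′ σ (first σ) ≡ position (second σ) S′
  g′-first σ = cong (λ y → position y S′) (successorOr-splice-first _ P Q (first∉W σ ∘ ∈-++⁺ˡ))

  g′-second : ∀ σ → g′ σ (second σ) ≡ ξ (threshold σ) (g v)
  g′-second σ = begin
    position (successorOr (headOr (second σ) (W′ σ)) (W′ σ) (second σ)) S′
      ≡⟨ cong (λ h → position (successorOr h (W′ σ) (second σ)) S′) (headOr-splice v _ P Q v∉P) ⟩
    position (successorOr (rename (first σ) v (headOr v W)) (W′ σ) (second σ)) S′
      ≡⟨ cong (λ y → position y S′)
              (successorOr-splice-second (headOr v W) P Q (second∉W σ ∘ ∈-++⁺ˡ) v∉P v∉Q (second≢first σ)) ⟩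
    position (rename (first σ) v (successor W v)) S′
      ≡⟨ position-rename σ (successor W v) (successor-W-≢ a∉W (a≢v ∘ sym)) (successor-W-≢ b∉W (b≢v ∘ sym)) ⟩
    ξ (threshold σ) (g v) ∎

  map-g′ : ∀ σ {C} → a ∉ C → b ∉ C → v ∉ C → map (g′ σ) C ≡ map (ξ (threshold σ)) (map g C)
  map-g′ σ {C} a∉C b∉C v∉C = begin
    map (g′ σ) C
      ≡⟨ map-cong-local (All.tabulate λ x∈C →
           g′-outside σ _ (∈∉⇒≢ x∈C a∉C) (∈∉⇒≢ x∈C b∉C) (∈∉⇒≢ x∈C v∉C)) ⟩
    map (ξ (threshold σ) ∘ g) C
      ≡⟨ map-∘ C ⟩
    map (ξ (threshold σ)) (map g C) ∎

  cycle-W′ : ∀ σ → cycleOneLine S′ (W′ σ) ≡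
    map (ξ (threshold σ)) (map g A) ++ g′ σ a ∷ g′ σ b ∷ map (ξ (threshold σ)) (map g B)
  cycle-W′ σ = begin
    map (g′ σ) (A ++ a ∷ b ∷ B)
      ≡⟨ map-++ (g′ σ) A (a ∷ b ∷ B) ⟩
    map (g′ σ) A ++ g′ σ a ∷ g′ σ b ∷ map (g′ σ) B
      ≡⟨ cong₂ (λ X Y → X ++ g′ σ a ∷ g′ σ b ∷ Y)
               (map-g′ σ a∉A b∉A v∉A) (map-g′ σ a∉B b∉B v∉B) ⟩
    map (ξ (threshold σ)) (map g A) ++ g′ σ a ∷ g′ σ b ∷ map (ξ (threshold σ)) (map g B) ∎

  cycle-splice : ∀ σ → insert (just σ) (position v S) (cycleOneLine S W)
                         ≡ cycleOneLine S′ (P ++ orient σ [ a ] [ b ] ++ Q)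
  cycle-splice plus = begin
    posIns (position v S) (map g S)
      ≡⟨ cong₂ posIns position-v (map-++ g A (v ∷ B)) ⟩
    posIns i (map g A ++ g v ∷ map g B)
      ≡⟨ posIns-middle (map g A) (length-map g A) ⟩
    map (ξ (suc i)) (map g A) ++ suc i ∷ ξ (suc i) (g v) ∷ map (ξ (suc i)) (map g B)
      ≡⟨ cong₂ (λ x y → map (ξ (suc i)) (map g A) ++ x ∷ y ∷ map (ξ (suc i)) (map g B))
               (sym (trans (g′-first plus) (position-after A b∉A b≢a))) (sym (g′-second plus)) ⟩
    map (ξ (suc i)) (map g A) ++ g′ plus a ∷ g′ plus b ∷ map (ξ (suc i)) (map g B)
      ≡⟨ sym (cycle-W′ plus) ⟩
    cycleOneLine S′ (W′ plus) ∎
  cycle-splice minus = begin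
    negIns (position v S) (map g S)
      ≡⟨ cong₂ negIns position-v (map-++ g A (v ∷ B)) ⟩
    negIns i (map g A ++ g v ∷ map g B)
      ≡⟨ negIns-middle (map g A) (length-map g A) ⟩
    map (ξ i) (map g A) ++ ξ i (g v) ∷ i ∷ map (ξ i) (map g B)
      ≡⟨ cong₂ (λ x y → map (ξ i) (map g A) ++ x ∷ y ∷ map (ξ i) (map g B))
               (sym (g′-second minus)) (sym (trans (g′-first minus) (position-middle A a∉A))) ⟩
    map (ξ i) (map g A) ++ g′ minus a ∷ g′ minus b ∷ map (ξ i) (map g B)
      ≡⟨ sym (cycle-W′ minus) ⟩
    cycleOneLine S′ (W′ minus) ∎

-- The cyclic order in which the produced cycle visits the slots of a subtree:
-- a + node lists the slots of its left subtree before those of its right one,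
-- a − node the other way round.
wordSub : Sub → List Path
wordSub empty        = [ [] ]
wordSub (node s l r) = orient s (map (L ∷_) (wordSub l)) (map (R ∷_) (wordSub r))

cycleOf : Sub → List ℕ
cycleOf t = cycleOneLine (slotsSub t) (wordSub t)

branches-unique : ∀ {xs ys} → Unique xs → Unique ys → Unique (map (L ∷_) xs ++ map (R ∷_) ys)
branches-unique uxs uys = Unique.++⁺ (Unique.map⁺ ∷-injectiveʳ uxs) (Unique.map⁺ ∷-injectiveʳ uys) disjoint
  where
  disjoint : ∀ {p} → ¬ (p ∈ map (L ∷_) _ × p ∈ map (R ∷_) _)
  disjoint (p∈L , p∈R) with ∈-map⁻ (L ∷_) p∈L | ∈-map⁻ (R ∷_) p∈R
  ... | _ , _ , refl | _ , _ , ()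

slots-unique : ∀ t → Unique (slotsSub t)
slots-unique empty        = [] ∷ []
slots-unique (node _ l r) = branches-unique (slots-unique l) (slots-unique r)

orient-↭ : ∀ s xs ys → orient s xs ys ↭ xs ++ ys
orient-↭ plus  xs ys = ↭-refl
orient-↭ minus xs ys = ↭.++-comm ys xs

word↭slots : ∀ t → wordSub t ↭ slotsSub t
word↭slots empty        = ↭-refl
word↭slots (node s l r) =
  ↭-trans (orient-↭ s _ _) (↭.++⁺ (↭.map⁺ (L ∷_) (word↭slots l)) (↭.map⁺ (R ∷_) (word↭slots r)))

word-unique : ∀ t → Unique (wordSub t)
word-unique t = ↭ₛ.Unique-resp-↭ (setoid Path) (↭⇒↭ₛ (↭-sym (word↭slots t))) (slots-unique t)

word⊆slots : ∀ t → wordSub t ⊆ slotsSub t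
word⊆slots t = ↭.∈-resp-↭ (word↭slots t)

Replaces : (us ws xs ys : List Path) → Set
Replaces us ws xs ys = ∃₂ λ A B → xs ≡ A ++ us ++ B × ys ≡ A ++ ws ++ B

module _ {us ws : List Path} where

  Replaces-map : ∀ f {xs ys} → Replaces us ws xs ys → Replaces (map f us) (map f ws) (map f xs) (map f ys)
  Replaces-map f (A , B , refl , refl) = map f A , map f B , distrib us , distrib ws
    where
    distrib : ∀ zs → map f (A ++ zs ++ B) ≡ map f A ++ map f zs ++ map f B
    distrib zs = trans (map-++ f A (zs ++ B)) (cong (map f A ++_) (map-++ f zs B))

  Replaces-++ʳ : ∀ zs {xs ys} → Replaces us ws xs ys → Replaces us ws (xs ++ zs) (ys ++ zs)
  Replaces-++ʳ zs (A , B , refl , refl) = A , B ++ zs , reassoc us , reassoc ws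
    where
    reassoc : ∀ vs → (A ++ vs ++ B) ++ zs ≡ A ++ vs ++ B ++ zs
    reassoc vs = trans (++-assoc A (vs ++ B) zs) (cong (A ++_) (++-assoc vs B zs))

  Replaces-++ˡ : ∀ zs {xs ys} → Replaces us ws xs ys → Replaces us ws (zs ++ xs) (zs ++ ys)
  Replaces-++ˡ zs (A , B , refl , refl) = zs ++ A , B , sym (++-assoc zs A _) , sym (++-assoc zs A _)

  Replaces-orientˡ : ∀ s zs {xs ys} → Replaces us ws xs ys → Replaces us ws (orient s xs zs) (orient s ys zs)
  Replaces-orientˡ plus  zs = Replaces-++ʳ zs
  Replaces-orientˡ minus zs = Replaces-++ˡ zs

  Replaces-orientʳ : ∀ s zs {xs ys} → Replaces us ws xs ys → Replaces us ws (orient s zs xs) (orient s zs ys)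
  Replaces-orientʳ plus  zs = Replaces-++ˡ zs
  Replaces-orientʳ minus zs = Replaces-++ʳ zs

map-orient : ∀ f s (xs ys : List Path) → map f (orient s xs ys) ≡ orient s (map f xs) (map f ys)
map-orient f plus  xs ys = map-++ f xs ys
map-orient f minus xs ys = map-++ f ys xs

data AddsLeaf (σ : Sign) : Path → Sub → Sub → Set where
  here  : AddsLeaf σ [] empty (node σ empty empty)
  left  : ∀ {v s l l′ r} → AddsLeaf σ v l l′ → AddsLeaf σ (L ∷ v) (node s l r) (node s l′ r)
  right : ∀ {v s l r r′} → AddsLeaf σ v r r′ → AddsLeaf σ (R ∷ v) (node s l r) (node s l r′)

addsLeaf-slots : ∀ {σ v t t′} → AddsLeaf σ v t t′ →
  Replaces [ v ] (v ∷ʳ L ∷ v ∷ʳ R ∷ []) (slotsSub t) (slotsSub t′)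
addsLeaf-slots here                = [] , [] , refl , refl
addsLeaf-slots (left {r = r} add)  =
  Replaces-++ʳ (map (R ∷_) (slotsSub r)) (Replaces-map (L ∷_) (addsLeaf-slots add))
addsLeaf-slots (right {l = l} add) =
  Replaces-++ˡ (map (L ∷_) (slotsSub l)) (Replaces-map (R ∷_) (addsLeaf-slots add))

addsLeaf-word : ∀ {σ v t t′} → AddsLeaf σ v t t′ →
  Replaces [ v ] (orient σ [ v ∷ʳ L ] [ v ∷ʳ R ]) (wordSub t) (wordSub t′)
addsLeaf-word here = [] , [] , refl , sym (++-identityʳ _)
addsLeaf-word {σ} (left {v} {s} {r = r} add) =
  Replaces-orientˡ s (map (R ∷_) (wordSub r))
    (subst (λ ws → Replaces [ _ ] ws _ _) (map-orient (L ∷_) σ [ v ∷ʳ L ] [ v ∷ʳ R ])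
      (Replaces-map (L ∷_) (addsLeaf-word add)))
addsLeaf-word {σ} (right {v} {s} {l} add) =
  Replaces-orientʳ s (map (L ∷_) (wordSub l))
    (subst (λ ws → Replaces [ _ ] ws _ _) (map-orient (R ∷_) σ [ v ∷ʳ L ] [ v ∷ʳ R ])
      (Replaces-map (R ∷_) (addsLeaf-word add)))

cycle-addsLeaf : ∀ {σ v t t′} → AddsLeaf σ v t t′ →
  insert (just σ) (position v (slotsSub t)) (cycleOf t) ≡ cycleOf t′
-- The facts about t and t′ are bound first so that the rewrite reaches their types.
cycle-addsLeaf {σ} {v} {t} {t′} add
  with slots-unique t | slots-unique t′ | word-unique t | word⊆slots t
... | S-unique | S′-unique | W-unique | W⊆S
  with A , B , eS , eS′ ← addsLeaf-slots add | P , Q , eW , eW′ ← addsLeaf-word add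
  rewrite eS | eS′ | eW | eW′ =
  Splice.cycle-splice S-unique S′-unique W-unique W⊆S (++-∷-≢ v) (++-∷-≢ v) σ

restrictSub-cong : ∀ {K K′} s → (∀ p → K p ≡ K′ p) → restrictSub K s ≡ restrictSub K′ s
restrictSub-cong empty        _    = refl
restrictSub-cong (node _ l r) K≗K′ rewrite K≗K′ []
  | restrictSub-cong l (K≗K′ ∘ (L ∷_)) | restrictSub-cong r (K≗K′ ∘ (R ∷_)) = refl

restrictSub-false : ∀ {K} s → K [] ≡ false → restrictSub K s ≡ empty
restrictSub-false empty        _  = refl
restrictSub-false (node _ _ _) K[] rewrite K[] = refl

restrictSub-all : ∀ {K} s → (∀ p {σ} → signSub s p ≡ just σ → K p ≡ true) → restrictSub K s ≡ s
restrictSub-all empty        _    = refl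
restrictSub-all (node _ l r) kept rewrite kept [] refl
  | restrictSub-all l (kept ∘ (L ∷_)) | restrictSub-all r (kept ∘ (R ∷_)) = refl

restrictSub-addsLeaf : ∀ {K K′ σ} s v → signSub s v ≡ just σ →
  (∀ q d e → v ≡ q ++ d ∷ e → K q ≡ true) →
  K v ≡ false → K′ v ≡ true → K′ (v ∷ʳ L) ≡ false → K′ (v ∷ʳ R) ≡ false →
  (∀ p → p ≢ v → K p ≡ K′ p) →
  AddsLeaf σ v (restrictSub K s) (restrictSub K′ s)
restrictSub-addsLeaf {K′ = K′} (node _ l r) [] refl _ Kv K′v K′vL K′vR _
  rewrite Kv | K′v | restrictSub-false {K′ ∘ (L ∷_)} l K′vL | restrictSub-false {K′ ∘ (R ∷_)} r K′vR = here
restrictSub-addsLeaf (node _ l r) (L ∷ v) sign ancestors Kv K′v K′vL K′vR K≗K′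
  rewrite ancestors [] L v refl | trans (sym (K≗K′ [] λ ())) (ancestors [] L v refl)
  | restrictSub-cong r (λ p → K≗K′ (R ∷ p) λ ()) =
  left (restrictSub-addsLeaf l v sign (λ q d e v≡ → ancestors (L ∷ q) d e (cong (L ∷_) v≡)) Kv K′v K′vL K′vR
         (λ p p≢v → K≗K′ (L ∷ p) (p≢v ∘ ∷-injectiveʳ)))
restrictSub-addsLeaf (node _ l r) (R ∷ v) sign ancestors Kv K′v K′vL K′vR K≗K′
  rewrite ancestors [] R v refl | trans (sym (K≗K′ [] λ ())) (ancestors [] R v refl)
  | restrictSub-cong l (λ p → K≗K′ (L ∷ p) λ ()) =
  right (restrictSub-addsLeaf r v sign (λ q d e v≡ → ancestors (R ∷ q) d e (cong (R ∷_) v≡)) Kv K′v K′vL K′vR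
         (λ p p≢v → K≗K′ (R ∷ p) (p≢v ∘ ∷-injectiveʳ)))

keeps : List Path → Path → Bool
keeps ps []        = true
keeps ps p@(_ ∷ _) = p ∈ᵇ ps

-- The root is treated as a + node: its left slots precede its right ones in the
-- cycle, which for the root alone is 21.
asSub : Tree → Sub
asSub (root l r) = node plus l r

restrict-keeps : ∀ ps T → asSub (restrict ps T) ≡ restrictSub (keeps ps) (asSub T)
restrict-keeps ps (root l r) = refl

slots-asSub : ∀ T → slots T ≡ slotsSub (asSub T)
slots-asSub (root l r) = refl

signAt-root : ∀ T → signAt T [] ≡ nothing
signAt-root (root l r) = refl

signAt-asSub : ∀ T d p → signAt T (d ∷ p) ≡ signSub (asSub T) (d ∷ p)
signAt-asSub (root l r) L p = refl
signAt-asSub (root l r) R p = refl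

module _ {T : Tree} {ord : List Path} (po : ProcessingOrder T ord) where
  open ProcessingOrder po

  parent-precedes : ∀ {xs ys c q d} → ord ≡ xs ++ ys → c ∈ xs → c ≡ q ∷ʳ d → q ≢ [] → q ∈ xs
  parent-precedes {ys = ys} {c} eq c∈xs c≡ q≢[] with xs₁ , xs₂ , refl ← ∈-∃++ c∈xs =
    ∈-++⁺ˡ (parentFirst xs₁ c (xs₂ ++ ys) (trans eq (++-assoc xs₁ (c ∷ xs₂) ys)) _ _ c≡ q≢[])

  ancestor-precedes : ∀ {xs c ys} → ord ≡ xs ++ c ∷ ys → ∀ q d e → c ≡ q ++ d ∷ e → q ≢ [] → q ∈ xs
  ancestor-precedes eq q d []       c≡ q≢[] = parentFirst _ _ _ eq q d c≡ q≢[]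
  ancestor-precedes eq q d (d′ ∷ e) c≡ q≢[] =
    parent-precedes eq (ancestor-precedes eq (q ∷ʳ d) d′ e (trans c≡ (sym (∷ʳ-++ q d (d′ ∷ e)))) (∷ʳ-≢-[] q))
      refl q≢[]

  restrict-addsLeaf : ∀ done v vs {σ} → ord ≡ done ++ v ∷ vs → signAt T v ≡ just σ →
    AddsLeaf σ v (asSub (restrict done T)) (asSub (restrict (done ∷ʳ v) T))
  restrict-addsLeaf done [] vs eq sign with () ← trans (sym (signAt-root T)) sign
  restrict-addsLeaf done v@(d ∷ p) vs eq sign
    rewrite restrict-keeps done T | restrict-keeps (done ∷ʳ v) T =
    restrictSub-addsLeaf (asSub T) v (trans (sym (signAt-asSub T d p)) sign)
      ancestors-kept (∉⇒∈ᵇ-false v∉done) (∈⇒∈ᵇ (∈-++⁺ʳ done (here refl)))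
      (child-unkept L) (child-unkept R) others-unchanged
    where
    v∉done : v ∉ done
    v∉done = proj₁ (unique-middle done (subst Unique eq unique))

    ancestors-kept : ∀ q d e → v ≡ q ++ d ∷ e → keeps done q ≡ true
    ancestors-kept []          _ _ _  = refl
    ancestors-kept q@(_ ∷ _) d e v≡ = ∈⇒∈ᵇ (ancestor-precedes eq q d e v≡ λ ())

    child-unkept : ∀ d → keeps (done ∷ʳ v) (v ∷ʳ d) ≡ false
    child-unkept d = ∉⇒∈ᵇ-false child∉
      where
      child∉ : v ∷ʳ d ∉ done ∷ʳ v
      child∉ child∈ with ∈-++⁻ done child∈
      ... | inj₁ child∈done = v∉done (parent-precedes eq child∈done refl λ ())
      ... | inj₂ (here child≡v) = ++-∷-≢ v child≡v

    others-unchanged : ∀ p → p ≢ v → keeps done p ≡ keeps (done ∷ʳ v) p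
    others-unchanged []        _   = refl
    others-unchanged p@(_ ∷ _) p≢v = sym (∈ᵇ-∷ʳ-≢ done p≢v)

  all-kept : ∀ p {σ} → signSub (asSub T) p ≡ just σ → keeps ord p ≡ true
  all-kept []          _    = refl
  all-kept p@(d ∷ q) sign = ∈⇒∈ᵇ (complete p (_ , trans (signAt-asSub T d q) sign))

  processFrom-cycle : ∀ done vs → ord ≡ done ++ vs →
    processFrom T done vs (cycleOf (asSub (restrict done T))) ≡ cycleOf (asSub T)
  processFrom-cycle done [] eq = cong cycleOf (begin
    asSub (restrict done T)           ≡⟨ cong (λ ps → asSub (restrict ps T)) (sym (trans eq (++-identityʳ done))) ⟩
    asSub (restrict ord T)            ≡⟨ restrict-keeps ord T ⟩
    restrictSub (keeps ord) (asSub T) ≡⟨ restrictSub-all (asSub T) all-kept ⟩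
    asSub T                           ∎)
  processFrom-cycle done (v ∷ vs) eq with All.lookup nodes (subst (v ∈_) (sym eq) (∈-++⁺ʳ done (here refl)))
  ... | σ , sign rewrite sign | slots-asSub (restrict done T) =
    trans (cong (processFrom T (done ∷ʳ v) vs) (cycle-addsLeaf (restrict-addsLeaf done v vs eq sign)))
          (processFrom-cycle (done ∷ʳ v) vs (trans eq (sym (∷ʳ-++ done v vs))))

produce-cycle : ∀ {T ord} → ProcessingOrder T ord → produce T ord ≡ cycleOf (asSub T)
produce-cycle {root l r} {ord} po =
  trans (cong (processFrom (root l r) [] ord) start) (processFrom-cycle po [] ord refl)
  where
  start : 2 ∷ 1 ∷ [] ≡ cycleOf (asSub (restrict [] (root l r)))
  start = cong₂ (λ x y → cycleOf (node plus x y))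
    (sym (restrictSub-false {λ p → (L ∷ p) ∈ᵇ []} l refl))
    (sym (restrictSub-false {λ p → (R ∷ p) ∈ᵇ []} r refl))

mainTheorem6 : (T : Tree) (ord₁ ord₂ : List Path) →
    ProcessingOrder T ord₁ → ProcessingOrder T ord₂ →
    produce T ord₁ ≡ produce T ord₂
mainTheorem6 T ord₁ ord₂ po₁ po₂ = trans (produce-cycle po₁) (sym (produce-cycle po₂))
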